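{- If the finite semiring $R$ is $\{0,1\}$-free, then $R$ has a rank-function.
   Context: A semiring is $(R,+,\cdot)$ with $(R,+)$ a commutative semigroup, $(R,\cdot)$ a semigroup and two-sided distributivity; no identities are required. $R$ is $\{0,1\}$-free if no subsemiring $T$ contains an additive identity $0$ of $T$ and a multiplicative identity $1\neq 0$ of $T$. $E=E(R)$ is the set of multiplicative idempotents, $eRf=\{eaf\mid a\in R\}$. A rank-function for $R$ is a map $\mathsf{rank}:R\to\mathbb{N}\setminus\{0\}$ such that for all $a,b\in R$: (1) $\mathsf{rank}(a)\le\mathsf{rank}(a+b)$; (2) $\mathsf{rank}(a),\mathsf{rank}(b)\le\mathsf{rank}(ab)$; (3) if $a,b\in eRf$ for some $e,f\in E$ and $\mathsf{rank}(a)=\mathsf{rank}(a+b)$, then $a=a+b$. -}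

module Defs where

open import Level using (0ℓ)
open import Data.Nat using (ℕ; _≤_; _<_)
open import Data.Fin using (Fin)
open import Data.Product using (Σ; ∃; _×_; _,_)
open import Relation.Nullary using (¬_)
open import Relation.Binary.PropositionalEquality using (_≡_; _≢_)
open import Function.Bundles using (_↔_)

record SemiringNoId : Set₁ where
  infixl 6 _+_
  infixl 7 _*_
  field
    Carrier : Set
    _+_     : Carrier → Carrier → Carrier
    _*_     : Carrier → Carrier → Carrier
    +-assoc : ∀ a b c → (a + b) + c ≡ a + (b + c)
    +-comm  : ∀ a b → a + b ≡ b + a
    *-assoc : ∀ a b c → (a * b) * c ≡ a * (b * c)
    distribˡ : ∀ a b c → a * (b + c) ≡ (a * b) + (a * c)
    distribʳ : ∀ a b c → (b + c) * a ≡ (b * a) + (c * a)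

module _ (R : SemiringNoId) where
  open SemiringNoId R

  IsFinite : Set
  IsFinite = ∃ λ (n : ℕ) → Carrier ↔ Fin n

  IsSubsemiring : (Carrier → Set) → Set
  IsSubsemiring T =
    (∀ a b → T a → T b → T (a + b)) × (∀ a b → T a → T b → T (a * b))

  ZeroOneFree : Set₁
  ZeroOneFree =
    ¬ (Σ (Carrier → Set) λ T → IsSubsemiring T ×
        (Σ Carrier λ z → Σ Carrier λ o →
          T z × T o ×
          (∀ x → T x → z + x ≡ x) ×
          (∀ x → T x → (o * x ≡ x) × (x * o ≡ x)) ×
          (o ≢ z)))

  Idempotent : Carrier → Set
  Idempotent e = e * e ≡ e

  _∈_R_ : Carrier → Carrier → Carrier → Set
  a ∈ e R f = ∃ λ c → a ≡ (e * c) * f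

  record IsRankFunction (rank : Carrier → ℕ) : Set where
    field
      positive : ∀ a → 0 < rank a
      rank-+   : ∀ a b → rank a ≤ rank (a + b)
      rank-*ˡ  : ∀ a b → rank a ≤ rank (a * b)
      rank-*ʳ  : ∀ a b → rank b ≤ rank (a * b)
      rank-eq  : ∀ a b e f → Idempotent e → Idempotent f →
                 a ∈ e R f → b ∈ e R f →
                 rank a ≡ rank (a + b) → a ≡ a + b

  HasRankFunction : Set
  HasRankFunction = Σ (Carrier → ℕ) IsRankFunction

-- For a ∈ R let Above a be the set of y ∈ R lying additively above some
-- two-sided multiple UaV with U, V ∈ R¹ (R with an identity adjoined).  This set
-- shrinks when a is replaced by a + b, ab or ba, so rank a = 1 + #(R ∖ Above a)
-- satisfies (1) and (2).  For (3), equal ranks force Above a = Above (a + b),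
-- so U(a+b)V ≼ a for some U, V; with a, b ∈ eRf this can be normalised to
-- corner elements u ∈ eRe, v ∈ fRf.  Passing to idempotent powers g = u^M,
-- h = v^M and to the additively idempotent multiples κx = (1+K)x (M and K are
-- exponents that work uniformly in the finite semiring) gives a ⊒ κ(gbh).
-- {0,1}-freeness then shows κg ⊒ κe ⊒ e and κh ⊒ κf ⊒ f, where x ⊒ y means
-- x + y = x ("x absorbs y"), and a short absorption chain yields a ⊒ b, i.e. a = a + b.
module Submission where

open import Defs
open import Level using (0ℓ)
import Data.Nat as Nat
open Nat using (ℕ; zero; suc; _≤_; _<_; z≤n; s≤s)
import Data.Nat.Properties as ℕ
open import Data.Nat.Tactic.RingSolver using (solve-∀)
open import Data.Fin as Fin using (Fin)
import Data.Fin.Properties as FinP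
open import Data.Product using (∃; ∃₂; _×_; _,_; proj₁; proj₂)
open import Data.Sum using (_⊎_; inj₁; inj₂)
open import Data.Maybe using (Maybe; just; nothing)
open import Data.Empty using (⊥-elim)
open import Function using (_∘_)
open import Function.Bundles using (_↔_; Inverse; Injection)
open import Function.Properties.Inverse using (↔⇒↣)
open import Algebra.Bundles using (CommutativeSemigroup)
import Algebra.Properties.CommutativeSemigroup as CommSemigroupProperties
open import Relation.Nullary using (¬_; Dec; yes; no)
open import Relation.Nullary.Decidable using (map′; _⊎-dec_; ¬?; decidable-stable)
open import Relation.Unary using (Pred; Decidable; _⊆_)
open import Relation.Binary.Definitions using (DecidableEquality)
open import Relation.Binary.PropositionalEquality

-- ℕ's + and * are opened only in this block (exponents and counting): the
-- semiring operations below use the same symbols.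
module _ where
  open Nat using (_+_; _*_)

  -- Exponent arithmetic.  Without identities we index powers from 1:
  -- pow k x = x^(1+k).  Since (1+i)(1+j) = 1 + (i ⊙ j), the exponent of an
  -- iterated power is i ⊙ j.
  _⊙_ : ℕ → ℕ → ℕ
  i ⊙ j = i * j + i + j

  ⊙-comm : ∀ i j → i ⊙ j ≡ j ⊙ i
  ⊙-comm = unfolded
    where
    unfolded : ∀ i j → i * j + i + j ≡ j * i + j + i
    unfolded = solve-∀

  ⊙-identityʳ : ∀ i → i ⊙ 0 ≡ i
  ⊙-identityʳ = unfolded
    where
    unfolded : ∀ i → i * 0 + i + 0 ≡ i
    unfolded = solve-∀

  module Powers {A : Set} (_∙_ : A → A → A)
                (∙-assoc : ∀ x y z → (x ∙ y) ∙ z ≡ x ∙ (y ∙ z)) where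
    open ≡-Reasoning

    IsIdempotent : A → Set
    IsIdempotent y = y ∙ y ≡ y

    pow : ℕ → A → A
    pow zero    x = x
    pow (suc k) x = pow k x ∙ x

    pow-add : ∀ i j x → pow i x ∙ pow j x ≡ pow (suc (i + j)) x
    pow-add i zero    x = cong (λ t → pow (suc t) x) (sym (ℕ.+-identityʳ i))
    pow-add i (suc j) x = begin
      pow i x ∙ (pow j x ∙ x)     ≡⟨ sym (∙-assoc _ _ _) ⟩
      (pow i x ∙ pow j x) ∙ x     ≡⟨ cong (_∙ x) (pow-add i j x) ⟩
      pow (suc (suc (i + j))) x   ≡⟨ cong (λ t → pow (suc t) x) (sym (ℕ.+-suc i j)) ⟩
      pow (suc (i + suc j)) x     ∎

    pow-comm : ∀ k x → x ∙ pow k x ≡ pow k x ∙ x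
    pow-comm k x = pow-add 0 k x

    pow-pow : ∀ i j x → pow i (pow j x) ≡ pow (i ⊙ j) x
    pow-pow zero    j x = refl
    pow-pow (suc i) j x = begin
      pow i (pow j x) ∙ pow j x   ≡⟨ cong (_∙ pow j x) (pow-pow i j x) ⟩
      pow (i ⊙ j) x ∙ pow j x     ≡⟨ pow-add (i ⊙ j) j x ⟩
      pow (suc (i ⊙ j + j)) x     ≡⟨ cong (λ t → pow t x) (exponent i j) ⟩
      pow (suc i ⊙ j) x           ∎
      where
      exponent : ∀ i j → suc ((i * j + i + j) + j) ≡ suc i * j + suc i + j
      exponent = solve-∀

    pow-idempotent : ∀ {y} → IsIdempotent y → ∀ k → pow k y ≡ y
    pow-idempotent yy zero    = refl
    pow-idempotent yy (suc k) = trans (cong (_∙ _) (pow-idempotent yy k)) yy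

    idempotent-multipleˡ : ∀ j k x → IsIdempotent (pow k x) → IsIdempotent (pow (j ⊙ k) x)
    idempotent-multipleˡ j k x idem =
      subst IsIdempotent (trans (sym (pow-idempotent idem j)) (pow-pow j k x)) idem

    idempotent-multipleʳ : ∀ j k x → IsIdempotent (pow k x) → IsIdempotent (pow (k ⊙ j) x)
    idempotent-multipleʳ j k x idem =
      subst (λ t → IsIdempotent (pow t x)) (⊙-comm j k) (idempotent-multipleˡ j k x idem)

    pow-fixedˡ : ∀ {e x} → e ∙ x ≡ x → ∀ k → e ∙ pow k x ≡ pow k x
    pow-fixedˡ ex zero    = ex
    pow-fixedˡ ex (suc k) = trans (sym (∙-assoc _ _ _)) (cong (_∙ _) (pow-fixedˡ ex k))

    pow-fixedʳ : ∀ {e x} → x ∙ e ≡ x → ∀ k → pow k x ∙ e ≡ pow k x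
    pow-fixedʳ xe zero    = xe
    pow-fixedʳ {x = x} xe (suc k) = trans (∙-assoc (pow k x) x _) (cong (pow k x ∙_) xe)

    module Periodic {x : A} {i p : ℕ} (period : pow i x ≡ pow (i + p) x) where

      periodic-beyond : ∀ s → pow (s + i) x ≡ pow (s + i + p) x
      periodic-beyond zero    = period
      periodic-beyond (suc s) = cong (_∙ x) (periodic-beyond s)

      periodic-multiples : ∀ m s → pow (s + i) x ≡ pow (s + m * p + i) x
      periodic-multiples zero    s = cong (λ t → pow (t + i) x) (sym (ℕ.+-identityʳ s))
      periodic-multiples (suc m) s = begin
        pow (s + i) x                   ≡⟨ periodic-multiples m s ⟩
        pow ((s + m * p) + i) x         ≡⟨ periodic-beyond (s + m * p) ⟩
        pow ((s + m * p) + i + p) x     ≡⟨ cong (λ t → pow t x) (exponent s m p i) ⟩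
        pow (s + suc m * p + i) x       ∎
        where
        exponent : ∀ s m p i → (s + m * p) + i + p ≡ s + suc m * p + i
        exponent = solve-∀

    periodic⇒idempotent : ∀ {x i o} → pow i x ≡ pow (i + suc o) x →
                          IsIdempotent (pow (i * o + o + i) x)
    periodic⇒idempotent {x} {i} {o} period = begin
      pow k x ∙ pow k x                       ≡⟨ pow-add k k x ⟩
      pow (suc (k + k)) x                     ≡⟨ cong (λ t → pow t x) (exponent i o) ⟩
      pow (i * o + o + suc i * suc o + i) x   ≡⟨ sym (periodic-multiples (suc i) (i * o + o)) ⟩
      pow k x                                 ∎
      where
      open Periodic {x} {i} {suc o} period
      k : ℕ
      k = i * o + o + i
      exponent : ∀ i o → suc ((i * o + o + i) + (i * o + o + i)) ≡ i * o + o + suc i * suc o + i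
      exponent = solve-∀

    module Finite {n : ℕ} (enum : A ↔ Fin n) where
      open Inverse enum using (to; from; strictlyInverseʳ)

      -- pigeonhole on x, x², …, x^(n+1) gives x^(1+i) = x^(1+j) with i < j
      idempotent-power : ∀ x → ∃ λ k → IsIdempotent (pow k x)
      idempotent-power x
        with FinP.pigeonhole (ℕ.n<1+n n) (λ i → to (pow (Fin.toℕ i) x))
      ... | i , j , i<j , same with ℕ.m≤n⇒∃[o]m+o≡n i<j
      ... | o , 1+i+o≡j = Fin.toℕ i * o + o + Fin.toℕ i , periodic⇒idempotent {x} {Fin.toℕ i} {o} period
        where
        period : pow (Fin.toℕ i) x ≡ pow (Fin.toℕ i + suc o) x
        period = trans (Injection.injective (↔⇒↣ enum) same)
                       (cong (λ t → pow t x) (trans (sym 1+i+o≡j) (sym (ℕ.+-suc (Fin.toℕ i) o))))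

      uniform-exponent-family : ∀ {m} (g : Fin m → A) → ∃ λ K → ∀ i → IsIdempotent (pow K (g i))
      uniform-exponent-family {zero}  g = 0 , λ ()
      uniform-exponent-family {suc m} g
        with idempotent-power (g Fin.zero) | uniform-exponent-family (g ∘ Fin.suc)
      ... | k , idem | K , idems = K ⊙ k , λ
        { Fin.zero    → idempotent-multipleˡ K k _ idem
        ; (Fin.suc i) → idempotent-multipleʳ k K _ (idems i) }

      uniform-exponent : ∃ λ K → ∀ x → IsIdempotent (pow K x)
      uniform-exponent with uniform-exponent-family from
      ... | K , idems = K , λ x → subst (λ y → IsIdempotent (pow K y)) (strictlyInverseʳ x) (idems (to x))

  indicator : {A : Set} → Dec A → ℕ
  indicator (yes _) = 1
  indicator (no _)  = 0

  indicator-mono : {A B : Set} → (A → B) → (a : Dec A) (b : Dec B) → indicator a ≤ indicator b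
  indicator-mono A→B (yes a) (yes _) = s≤s z≤n
  indicator-mono A→B (yes a) (no ¬b) = ⊥-elim (¬b (A→B a))
  indicator-mono A→B (no _)  _       = z≤n

  count : ∀ {n} {P : Pred (Fin n) 0ℓ} → Decidable P → ℕ
  count {zero}  P? = 0
  count {suc n} P? = indicator (P? Fin.zero) + count (P? ∘ Fin.suc)

  count-mono : ∀ {n} {P Q : Pred (Fin n) 0ℓ} (P? : Decidable P) (Q? : Decidable Q) →
               P ⊆ Q → count P? ≤ count Q?
  count-mono {zero}  P? Q? P⊆Q = z≤n
  count-mono {suc n} P? Q? P⊆Q =
    ℕ.+-mono-≤ (indicator-mono P⊆Q (P? Fin.zero) (Q? Fin.zero)) (count-mono (P? ∘ Fin.suc) (Q? ∘ Fin.suc) P⊆Q)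

  count-strict : ∀ {n} {P Q : Pred (Fin n) 0ℓ} (P? : Decidable P) (Q? : Decidable Q) →
                 P ⊆ Q → ∀ i → Q i → ¬ P i → count P? < count Q?
  count-strict {suc n} P? Q? P⊆Q Fin.zero q ¬p with P? Fin.zero | Q? Fin.zero
  ... | yes p | _      = ⊥-elim (¬p p)
  ... | no _  | no ¬q  = ⊥-elim (¬q q)
  ... | no _  | yes _  = s≤s (count-mono (P? ∘ Fin.suc) (Q? ∘ Fin.suc) P⊆Q)
  count-strict {suc n} P? Q? P⊆Q (Fin.suc i) q ¬p =
    ℕ.+-mono-≤-< (indicator-mono P⊆Q (P? Fin.zero) (Q? Fin.zero))
                 (count-strict (P? ∘ Fin.suc) (Q? ∘ Fin.suc) P⊆Q i q ¬p)

  count-≡⇒⊇ : ∀ {n} {P Q : Pred (Fin n) 0ℓ} (P? : Decidable P) (Q? : Decidable Q) →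
              P ⊆ Q → count P? ≡ count Q? → Q ⊆ P
  count-≡⇒⊇ P? Q? P⊆Q same {i} q with P? i
  ... | yes p = p
  ... | no ¬p = ⊥-elim (ℕ.<-irrefl same (count-strict P? Q? P⊆Q i q ¬p))

module SemiringTheory (R : SemiringNoId) where
  open SemiringNoId R
  open ≡-Reasoning

  +-commutativeSemigroup : CommutativeSemigroup 0ℓ 0ℓ
  +-commutativeSemigroup = record
    { Carrier = Carrier
    ; _≈_     = _≡_
    ; _∙_     = _+_
    ; isCommutativeSemigroup = record
      { isSemigroup = record
        { isMagma = record { isEquivalence = isEquivalence ; ∙-cong = cong₂ _+_ }
        ; assoc   = +-assoc }
      ; comm = +-comm } }

  open CommSemigroupProperties +-commutativeSemigroup using (interchange; xy∙z≈xz∙y)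

  module Add = Powers _+_ +-assoc
  module Mul = Powers _*_ *-assoc

  -- times k x = (1+k)·x
  times : ℕ → Carrier → Carrier
  times = Add.pow

  times-*ʳ : ∀ j x y → times j (x * y) ≡ times j x * y
  times-*ʳ zero    x y = refl
  times-*ʳ (suc j) x y = trans (cong (_+ x * y) (times-*ʳ j x y)) (sym (distribʳ y (times j x) x))

  times-*ˡ : ∀ j x y → times j (x * y) ≡ x * times j y
  times-*ˡ zero    x y = refl
  times-*ˡ (suc j) x y = trans (cong (_+ x * y) (times-*ˡ j x y)) (sym (distribˡ x (times j y) y))

  times-* : ∀ i j x y → times i x * times j y ≡ times i (times j (x * y))
  times-* i j x y = begin
    times i x * times j y       ≡⟨ sym (times-*ʳ i x (times j y)) ⟩
    times i (x * times j y)     ≡⟨ cong (times i) (sym (times-*ˡ j x y)) ⟩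
    times i (times j (x * y))   ∎

  infix 4 _absorbs_ _≼_
  _absorbs_ : Carrier → Carrier → Set
  x absorbs y = x + y ≡ x

  absorbs-trans : ∀ {x y z} → x absorbs y → y absorbs z → x absorbs z
  absorbs-trans {x} {y} {z} x⊒y y⊒z = begin
    x + z         ≡⟨ cong (_+ z) (sym x⊒y) ⟩
    (x + y) + z   ≡⟨ +-assoc x y z ⟩
    x + (y + z)   ≡⟨ cong (x +_) y⊒z ⟩
    x + y         ≡⟨ x⊒y ⟩
    x             ∎

  absorbs-*ʳ : ∀ {x y} c → x absorbs y → (x * c) absorbs (y * c)
  absorbs-*ʳ {x} {y} c x⊒y = trans (sym (distribʳ c x y)) (cong (_* c) x⊒y)

  absorbs-*ˡ : ∀ {x y} c → x absorbs y → (c * x) absorbs (c * y)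
  absorbs-*ˡ {x} {y} c x⊒y = trans (sym (distribˡ c x y)) (cong (c *_) x⊒y)

  absorbs-summand : ∀ {x y} → y + y ≡ y → (x + y) absorbs y
  absorbs-summand {x} {y} yy = trans (+-assoc x y y) (cong (x +_) yy)

  -- If G ⊒ E ⊒ e and H ⊒ F ⊒ f, every b ∈ eRf is absorbed by G b H, along
  -- the chain G b H ⊒ E b H ⊒ E b F ⊒ E b ⊒ b.
  absorbs-through-corners : ∀ {G E e H F f b} →
    G absorbs E → E absorbs e → H absorbs F → F absorbs f →
    e * b ≡ b → b * f ≡ b → ((G * b) * H) absorbs b
  absorbs-through-corners {G} {E} {e} {H} {F} {f} {b} G⊒E E⊒e H⊒F F⊒f eb bf =
    absorbs-trans (absorbs-*ʳ H (absorbs-*ʳ b G⊒E))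
    (absorbs-trans (absorbs-*ˡ (E * b) H⊒F)
    (absorbs-trans (subst ((E * b) * F absorbs_) Ebf≡Eb (absorbs-*ˡ (E * b) F⊒f))
                   (subst (E * b absorbs_) eb (absorbs-*ʳ b E⊒e))))
    where
    Ebf≡Eb : (E * b) * f ≡ E * b
    Ebf≡Eb = trans (*-assoc E b f) (cong (E *_) bf)

  _≼_ : Carrier → Carrier → Set
  x ≼ y = (y ≡ x) ⊎ ∃ λ r → y ≡ x + r

  ≼-refl : ∀ {x} → x ≼ x
  ≼-refl = inj₁ refl

  ≼-trans : ∀ {x y z} → x ≼ y → y ≼ z → x ≼ z
  ≼-trans (inj₁ refl)       y≼z         = y≼z
  ≼-trans (inj₂ (r , refl)) (inj₁ refl) = inj₂ (r , refl)
  ≼-trans {x} (inj₂ (r , refl)) (inj₂ (s , refl)) = inj₂ (r + s , +-assoc x r s)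

  ≼-+ʳ : ∀ {x y} z → x ≼ y → (x + z) ≼ (y + z)
  ≼-+ʳ z (inj₁ refl)         = ≼-refl
  ≼-+ʳ {x} z (inj₂ (r , refl)) = inj₂ (r , xy∙z≈xz∙y x r z)

  ≼-absorbs : ∀ {x a y} → x ≼ a → x absorbs y → a absorbs y
  ≼-absorbs (inj₁ refl) x⊒y = x⊒y
  ≼-absorbs {x} {y = y} (inj₂ (r , refl)) x⊒y =
    trans (xy∙z≈xz∙y x r y) (cong (_+ r) x⊒y)

  sandwich : Carrier → Carrier → Carrier → Carrier
  sandwich g h x = (g * x) * h

  sandwich-+ : ∀ g h x y → sandwich g h (x + y) ≡ sandwich g h x + sandwich g h y
  sandwich-+ g h x y = trans (cong (_* h) (distribˡ g x y)) (distribʳ h (g * x) (g * y))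

  sandwich-times : ∀ g h j x → sandwich g h (times j x) ≡ times j (sandwich g h x)
  sandwich-times g h j x = trans (cong (_* h) (sym (times-*ˡ j g x))) (sym (times-*ʳ j (g * x) h))

  sandwich-sandwich : ∀ g h g′ h′ x → sandwich g h (sandwich g′ h′ x) ≡ sandwich (g * g′) (h′ * h) x
  sandwich-sandwich g h g′ h′ x = begin
    (g * ((g′ * x) * h′)) * h    ≡⟨ cong (_* h) (sym (*-assoc g (g′ * x) h′)) ⟩
    ((g * (g′ * x)) * h′) * h    ≡⟨ *-assoc (g * (g′ * x)) h′ h ⟩
    (g * (g′ * x)) * (h′ * h)    ≡⟨ cong (_* (h′ * h)) (sym (*-assoc g g′ x)) ⟩
    ((g * g′) * x) * (h′ * h)    ∎

  ≼-sandwich : ∀ g h {x y} → x ≼ y → sandwich g h x ≼ sandwich g h y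
  ≼-sandwich g h (inj₁ refl)     = ≼-refl
  ≼-sandwich g h {x} (inj₂ (r , refl)) = inj₂ (sandwich g h r , sandwich-+ g h x r)

  sandwich-powers : ∀ {u v a b} → sandwich u v (a + b) ≼ a →
    ∀ k → sandwich (Mul.pow k u) (Mul.pow k v) (a + b) ≼ a
  sandwich-powers bound zero = bound
  sandwich-powers {u} {v} {a} {b} bound (suc k) =
    subst (_≼ a) (sym unfold)
      (≼-trans (≼-sandwich u v (sandwich-powers bound k))
      (≼-trans (inj₂ (sandwich u v b , sandwich-+ u v a b)) bound))
    where
    unfold : sandwich (Mul.pow (suc k) u) (Mul.pow (suc k) v) (a + b)
           ≡ sandwich u v (sandwich (Mul.pow k u) (Mul.pow k v) (a + b))
    unfold = trans (cong (λ g → sandwich g (Mul.pow (suc k) v) (a + b)) (sym (Mul.pow-comm k u)))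
                   (sym (sandwich-sandwich u v _ _ (a + b)))

  -- For idempotent g, h: if g(a+b)h ≼ a then gah + (1+j)·gbh ≼ a for all j,
  -- since gah + (1+j)·gbh is fixed by sandwiching and so lies below gah.
  sandwich-multiples : ∀ {g h a b} → g * g ≡ g → h * h ≡ h → sandwich g h (a + b) ≼ a →
    ∀ j → (sandwich g h a + times j (sandwich g h b)) ≼ a
  sandwich-multiples {g} {h} {a} {b} gg hh bound zero = subst (_≼ a) (sandwich-+ g h a b) bound
  sandwich-multiples {g} {h} {a} {b} gg hh bound (suc j) =
    subst (_≼ a) (+-assoc c (times j γ) γ) (≼-trans (≼-+ʳ γ below-c) c+γ≼a)
    where
    c γ : Carrier
    c = sandwich g h a
    γ = sandwich g h b
    c+γ≼a : c + γ ≼ a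
    c+γ≼a = subst (_≼ a) (sandwich-+ g h a b) bound
    fixed-by-sandwich : ∀ x → sandwich g h (sandwich g h x) ≡ sandwich g h x
    fixed-by-sandwich x = trans (sandwich-sandwich g h g h x) (cong₂ (λ p q → sandwich p q x) gg hh)
    fixed : sandwich g h (c + times j γ) ≡ c + times j γ
    fixed = begin
      sandwich g h (c + times j γ)                     ≡⟨ sandwich-+ g h c (times j γ) ⟩
      sandwich g h c + sandwich g h (times j γ)        ≡⟨ cong₂ _+_ (fixed-by-sandwich a)
                                                           (trans (sandwich-times g h j γ)
                                                                  (cong (times j) (fixed-by-sandwich b))) ⟩
      c + times j γ                                    ∎
    below-c : c + times j γ ≼ c
    below-c = subst (_≼ c) fixed (≼-sandwich g h (sandwich-multiples gg hh bound j))

  -- R¹ = R with an identity adjoined (nothing); its actions on R.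
  _◃_ : Maybe Carrier → Carrier → Carrier
  nothing ◃ x = x
  just u  ◃ x = u * x

  _▹_ : Carrier → Maybe Carrier → Carrier
  x ▹ nothing = x
  x ▹ just v  = x * v

  ◃-* : ∀ U x y → U ◃ (x * y) ≡ (U ◃ x) * y
  ◃-* nothing  x y = refl
  ◃-* (just u) x y = sym (*-assoc u x y)

  ▹-* : ∀ V x y → (x * y) ▹ V ≡ x * (y ▹ V)
  ▹-* nothing  x y = refl
  ▹-* (just v) x y = *-assoc x y v

  ◃▹-+ : ∀ U V x y → (U ◃ (x + y)) ▹ V ≡ ((U ◃ x) ▹ V) + ((U ◃ y) ▹ V)
  ◃▹-+ nothing  nothing  x y = refl
  ◃▹-+ nothing  (just v) x y = distribʳ v x y
  ◃▹-+ (just u) nothing  x y = distribˡ u x y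
  ◃▹-+ (just u) (just v) x y = trans (cong (_* v) (distribˡ u x y)) (distribʳ v (u * x) (u * y))

  Above : Carrier → Carrier → Set
  Above a y = ∃₂ λ U V → ((U ◃ a) ▹ V) ≼ y

  Above-refl : ∀ a → Above a a
  Above-refl a = nothing , nothing , ≼-refl

  Above-+ : ∀ {a b y} → Above (a + b) y → Above a y
  Above-+ {a} {b} (U , V , above) =
    U , V , ≼-trans (inj₂ (_ , ◃▹-+ U V a b)) above

  Above-*ˡ : ∀ {a b y} → Above (a * b) y → Above a y
  Above-*ˡ {a} {b} (U , V , above) =
    U , just (b ▹ V) , subst (_≼ _) (trans (cong (_▹ V) (◃-* U a b)) (▹-* V (U ◃ a) b)) above

  Above-*ʳ : ∀ {a b y} → Above (a * b) y → Above b y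
  Above-*ʳ {a} {b} (U , V , above) =
    just (U ◃ a) , V , subst (_≼ _) (cong (_▹ V) (◃-* U a b)) above

  ∈-corner : ∀ {a e f} → e * e ≡ e → f * f ≡ f → _∈_R_ R a e f → (e * a ≡ a) × (a * f ≡ a)
  ∈-corner {e = e} {f} ee ff (c , refl) =
    trans (sym (*-assoc e (e * c) f)) (cong (_* f) (trans (sym (*-assoc e e c)) (cong (_* c) ee))) ,
    trans (*-assoc (e * c) f f) (cong ((e * c) *_) ff)

  leftCorner : Carrier → Maybe Carrier → Carrier
  leftCorner e U = e * (U ◃ e)

  rightCorner : Maybe Carrier → Carrier → Carrier
  rightCorner V f = (f ▹ V) * f

  leftCorner-fixed : ∀ {e} U → e * e ≡ e → (e * leftCorner e U ≡ leftCorner e U) × (leftCorner e U * e ≡ leftCorner e U)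
  leftCorner-fixed {e} U ee =
    trans (sym (*-assoc e e (U ◃ e))) (cong (_* (U ◃ e)) ee) ,
    trans (*-assoc e (U ◃ e) e) (cong (e *_) (trans (sym (◃-* U e e)) (cong (U ◃_) ee)))

  rightCorner-fixed : ∀ {f} V → f * f ≡ f → (f * rightCorner V f ≡ rightCorner V f) × (rightCorner V f * f ≡ rightCorner V f)
  rightCorner-fixed {f} V ff =
    trans (sym (*-assoc f (f ▹ V) f)) (cong (_* f) (trans (sym (▹-* V f f)) (cong (_▹ V) ff))) ,
    trans (*-assoc (f ▹ V) f f) (cong ((f ▹ V) *_) ff)

  corner-normal-form : ∀ {e f x} U V → e * x ≡ x → x * f ≡ x →
    sandwich e f ((U ◃ x) ▹ V) ≡ sandwich (leftCorner e U) (rightCorner V f) x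
  corner-normal-form {e} {f} {x} U V ex xf = begin
    sandwich e f ((U ◃ x) ▹ V)                  ≡⟨ cong (λ y → sandwich e f ((U ◃ y) ▹ V)) (sym ex) ⟩
    sandwich e f ((U ◃ (e * x)) ▹ V)            ≡⟨ cong (λ y → sandwich e f (y ▹ V)) (◃-* U e x) ⟩
    sandwich e f (((U ◃ e) * x) ▹ V)            ≡⟨ cong (sandwich e f) (▹-* V (U ◃ e) x) ⟩
    sandwich e f ((U ◃ e) * (x ▹ V))            ≡⟨ cong (λ y → sandwich e f ((U ◃ e) * (y ▹ V))) (sym xf) ⟩
    sandwich e f ((U ◃ e) * ((x * f) ▹ V))      ≡⟨ cong (λ y → sandwich e f ((U ◃ e) * y)) (▹-* V x f) ⟩
    sandwich e f ((U ◃ e) * (x * (f ▹ V)))      ≡⟨ cong (sandwich e f) (sym (*-assoc (U ◃ e) x (f ▹ V))) ⟩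
    sandwich e f (sandwich (U ◃ e) (f ▹ V) x)   ≡⟨ sandwich-sandwich e f (U ◃ e) (f ▹ V) x ⟩
    sandwich (leftCorner e U) (rightCorner V f) x ∎

  -- The absorption principle of {0,1}-free semirings: if z is idempotent for
  -- both operations, w is multiplicatively idempotent and z w = w z = z, then
  -- {z} ∪ {z + (1+j)w} is a subsemiring with zero z and identity z + w, so
  -- z + w cannot differ from z.
  module ZeroOneAbsorption (zof : ZeroOneFree R) {z w : Carrier}
      (z+z : z + z ≡ z) (z*z : z * z ≡ z) (z*w : z * w ≡ z) (w*z : w * z ≡ z) (w*w : w * w ≡ w) where

    t : ℕ → Carrier
    t j = times j w

    z+-absorbs : ∀ y → z + (z + y) ≡ z + y
    z+-absorbs y = trans (sym (+-assoc z z y)) (cong (_+ y) z+z)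

    z*t : ∀ j → z * t j ≡ z
    z*t j = trans (sym (times-*ˡ j z w)) (trans (cong (times j) z*w) (Add.pow-idempotent z+z j))

    t*z : ∀ j → t j * z ≡ z
    t*z j = trans (sym (times-*ʳ j w z)) (trans (cong (times j) w*z) (Add.pow-idempotent z+z j))

    t*t : ∀ i j → t i * t j ≡ t (i ⊙ j)
    t*t i j = trans (times-* i j w w) (trans (cong (λ y → times i (times j y)) w*w) (Add.pow-pow i j w))

    z*shift : ∀ j → z * (z + t j) ≡ z
    z*shift j = trans (distribˡ z z (t j)) (trans (cong₂ _+_ z*z (z*t j)) z+z)

    shift*z : ∀ j → (z + t j) * z ≡ z
    shift*z j = trans (distribʳ z z (t j)) (trans (cong₂ _+_ z*z (t*z j)) z+z)

    shift*shift : ∀ i j → (z + t i) * (z + t j) ≡ z + t (i ⊙ j)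
    shift*shift i j = begin
      (z + t i) * (z + t j)                 ≡⟨ distribʳ (z + t j) z (t i) ⟩
      z * (z + t j) + t i * (z + t j)       ≡⟨ cong₂ _+_ (z*shift j) (distribˡ (t i) z (t j)) ⟩
      z + (t i * z + t i * t j)             ≡⟨ cong₂ (λ p q → z + (p + q)) (t*z i) (t*t i j) ⟩
      z + (z + t (i ⊙ j))                   ≡⟨ z+-absorbs (t (i ⊙ j)) ⟩
      z + t (i ⊙ j)                         ∎

    shift+shift : ∀ i j → (z + t i) + (z + t j) ≡ z + t (suc (i Nat.+ j))
    shift+shift i j = trans (interchange z (t i) z (t j)) (cong₂ _+_ z+z (Add.pow-add i j w))

    T : Carrier → Set
    T x = (x ≡ z) ⊎ ∃ λ j → x ≡ z + t j

    closed-+ : ∀ x y → T x → T y → T (x + y)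
    closed-+ _ _ (inj₁ refl)       (inj₁ refl)       = inj₁ z+z
    closed-+ _ _ (inj₁ refl)       (inj₂ (j , refl)) = inj₂ (j , z+-absorbs (t j))
    closed-+ _ _ (inj₂ (i , refl)) (inj₁ refl)       = inj₂ (i , trans (+-comm (z + t i) z) (z+-absorbs (t i)))
    closed-+ _ _ (inj₂ (i , refl)) (inj₂ (j , refl)) = inj₂ (suc (i Nat.+ j) , shift+shift i j)

    closed-* : ∀ x y → T x → T y → T (x * y)
    closed-* _ _ (inj₁ refl)       (inj₁ refl)       = inj₁ z*z
    closed-* _ _ (inj₁ refl)       (inj₂ (j , refl)) = inj₁ (z*shift j)
    closed-* _ _ (inj₂ (i , refl)) (inj₁ refl)       = inj₁ (shift*z i)
    closed-* _ _ (inj₂ (i , refl)) (inj₂ (j , refl)) = inj₂ (i ⊙ j , shift*shift i j)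

    z-is-zero : ∀ x → T x → z + x ≡ x
    z-is-zero _ (inj₁ refl)       = z+z
    z-is-zero _ (inj₂ (j , refl)) = z+-absorbs (t j)

    z+w-is-one : ∀ x → T x → ((z + w) * x ≡ x) × (x * (z + w) ≡ x)
    z+w-is-one _ (inj₁ refl)       = shift*z 0 , z*shift 0
    z+w-is-one _ (inj₂ (j , refl)) =
      shift*shift 0 j , trans (shift*shift j 0) (cong (λ k → z + t k) (⊙-identityʳ j))

    not-not-absorbs : ¬ ¬ (z absorbs w)
    not-not-absorbs z+w≢z =
      zof (T , (closed-+ , closed-*) , z , z + w , inj₁ refl , inj₂ (0 , refl) ,
           z-is-zero , z+w-is-one , z+w≢z)

module FiniteZeroOneFree (R : SemiringNoId) (finite : IsFinite R) (zof : ZeroOneFree R) where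
  open SemiringNoId R
  open SemiringTheory R
  open ≡-Reasoning

  n : ℕ
  n = proj₁ finite

  enum : Carrier ↔ Fin n
  enum = proj₂ finite

  open Inverse enum using (to; from; strictlyInverseʳ)

  _≟_ : DecidableEquality Carrier
  _≟_ = FinP.inj⇒≟ (↔⇒↣ enum)

  ∃? : {P : Carrier → Set} → Decidable P → Dec (∃ P)
  ∃? {P} P? = map′ (λ (i , p) → from i , p)
                   (λ (x , p) → to x , subst P (sym (strictlyInverseʳ x)) p)
                   (FinP.any? (P? ∘ from))

  ∃¹? : {P : Maybe Carrier → Set} → Decidable P → Dec (∃ P)
  ∃¹? {P} P? = map′ join split (P? nothing ⊎-dec ∃? (P? ∘ just))
    where
    join : P nothing ⊎ ∃ (P ∘ just) → ∃ P
    join (inj₁ p)       = nothing , p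
    join (inj₂ (u , p)) = just u , p
    split : ∃ P → P nothing ⊎ ∃ (P ∘ just)
    split (nothing , p) = inj₁ p
    split (just u , p)  = inj₂ (u , p)

  _≼?_ : ∀ x y → Dec (x ≼ y)
  x ≼? y = (y ≟ x) ⊎-dec ∃? (λ r → y ≟ (x + r))

  Above? : ∀ a y → Dec (Above a y)
  Above? a y = ∃¹? (λ U → ∃¹? (λ V → ((U ◃ a) ▹ V) ≼? y))

  -- With decidable equality the absorption principle gives an equation.
  zero-one-absorption : ∀ {z w} → z + z ≡ z → z * z ≡ z → z * w ≡ z → w * z ≡ z → w * w ≡ w →
                        z absorbs w
  zero-one-absorption z+z z*z z*w w*z w*w =
    decidable-stable (_ ≟ _) (ZeroOneAbsorption.not-not-absorbs zof z+z z*z z*w w*z w*w)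

  K : ℕ
  K = proj₁ (Add.Finite.uniform-exponent enum)

  κ : Carrier → Carrier
  κ = times K

  κ-idempotent : ∀ x → κ x + κ x ≡ κ x
  κ-idempotent = proj₂ (Add.Finite.uniform-exponent enum)

  M : ℕ
  M = proj₁ (Mul.Finite.uniform-exponent enum)

  pow-M-idempotent : ∀ x → Mul.pow M x * Mul.pow M x ≡ Mul.pow M x
  pow-M-idempotent = proj₂ (Mul.Finite.uniform-exponent enum)

  κ-* : ∀ x y → κ x * κ y ≡ κ (x * y)
  κ-* x y = trans (times-* K K x y) (Add.pow-idempotent (κ-idempotent (x * y)) K)

  κ-absorbs : ∀ {e} → e * e ≡ e → κ e absorbs e
  κ-absorbs {e} ee = zero-one-absorption (κ-idempotent e) (trans (κ-* e e) (cong κ ee))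
    (trans (sym (times-*ʳ K e e)) (cong κ ee)) (trans (sym (times-*ˡ K e e)) (cong κ ee)) ee

  κ-absorbs-κ : ∀ {g e} → g * g ≡ g → e * e ≡ e → g * e ≡ g → e * g ≡ g → κ g absorbs κ e
  κ-absorbs-κ {g} {e} gg ee ge eg = zero-one-absorption (κ-idempotent g)
    (trans (κ-* g g) (cong κ gg)) (trans (κ-* g e) (cong κ ge))
    (trans (κ-* e g) (cong κ eg)) (trans (κ-* e e) (cong κ ee))

  cancellation : ∀ {a b e f} → e * e ≡ e → f * f ≡ f →
    e * a ≡ a → a * f ≡ a → e * b ≡ b → b * f ≡ b → Above (a + b) a → a absorbs b
  cancellation {a} {b} {e} {f} ee ff ea af eb bf (U , V , above) =
    absorbs-trans a⊒κγ (subst (_absorbs b) (sym κγ≡GbH)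
      (absorbs-through-corners (κ-absorbs-κ gg ee ge eg) (κ-absorbs ee)
                               (κ-absorbs-κ hh ff hf fh) (κ-absorbs ff) eb bf))
    where
    u v : Carrier
    u = leftCorner e U
    v = rightCorner V f
    corner-bound : sandwich u v (a + b) ≼ a
    corner-bound = subst₂ _≼_
      (corner-normal-form U V (trans (distribˡ e a b) (cong₂ _+_ ea eb))
                              (trans (distribʳ f a b) (cong₂ _+_ af bf)))
      (trans (cong (_* f) ea) af) (≼-sandwich e f above)
    g h γ : Carrier
    g = Mul.pow M u
    h = Mul.pow M v
    γ = sandwich g h b
    gg : g * g ≡ g
    gg = pow-M-idempotent u
    hh : h * h ≡ h
    hh = pow-M-idempotent v
    ge : g * e ≡ g
    ge = Mul.pow-fixedʳ (proj₂ (leftCorner-fixed U ee)) M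
    eg : e * g ≡ g
    eg = Mul.pow-fixedˡ (proj₁ (leftCorner-fixed U ee)) M
    hf : h * f ≡ h
    hf = Mul.pow-fixedʳ (proj₂ (rightCorner-fixed V ff)) M
    fh : f * h ≡ h
    fh = Mul.pow-fixedˡ (proj₁ (rightCorner-fixed V ff)) M
    a⊒κγ : a absorbs κ γ
    a⊒κγ = ≼-absorbs (sandwich-multiples gg hh (sandwich-powers corner-bound M) K)
                     (absorbs-summand (κ-idempotent γ))
    κγ≡GbH : κ γ ≡ (κ g * b) * κ h
    κγ≡GbH = begin
      κ ((g * b) * h)        ≡⟨ sym (κ-* (g * b) h) ⟩
      κ (g * b) * κ h        ≡⟨ cong (_* κ h) (times-*ʳ K g b) ⟩
      (κ g * b) * κ h        ∎

  NotAbove : Carrier → Pred (Fin n) 0ℓ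
  NotAbove a i = ¬ Above a (from i)

  notAbove? : ∀ a → Decidable (NotAbove a)
  notAbove? a i = ¬? (Above? a (from i))

  rank : Carrier → ℕ
  rank a = suc (count (notAbove? a))

  rank-mono : ∀ {a c} → (∀ {y} → Above c y → Above a y) → rank a ≤ rank c
  rank-mono Above-c⊆Above-a = s≤s (count-mono (notAbove? _) (notAbove? _) (λ ¬a c → ¬a (Above-c⊆Above-a c)))

  rank-≡⇒Above : ∀ a b → rank a ≡ rank (a + b) → Above (a + b) a
  rank-≡⇒Above a b same = subst (Above (a + b)) (strictlyInverseʳ a)
    (decidable-stable (Above? (a + b) (from (to a))) (λ ¬above →
      count-≡⇒⊇ (notAbove? a) (notAbove? (a + b)) (λ ¬a ab → ¬a (Above-+ ab)) (ℕ.suc-injective same)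
        ¬above (subst (Above a) (sym (strictlyInverseʳ a)) (Above-refl a))))

  isRankFunction : IsRankFunction R rank
  isRankFunction = record
    { positive = λ a → s≤s z≤n
    ; rank-+   = λ a b → rank-mono Above-+
    ; rank-*ˡ  = λ a b → rank-mono Above-*ˡ
    ; rank-*ʳ  = λ a b → rank-mono Above-*ʳ
    ; rank-eq  = λ a b e f ee ff a∈eRf b∈eRf same →
        let (ea , af) = ∈-corner ee ff a∈eRf
            (eb , bf) = ∈-corner ee ff b∈eRf
        in sym (cancellation ee ff ea af eb bf (rank-≡⇒Above a b same))
    }

lemma5p15 : (R : SemiringNoId) → IsFinite R → ZeroOneFree R → HasRankFunction R
lemma5p15 R finite zof = rank , isRankFunction
  where open FiniteZeroOneFree R finite zof
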